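{- Let $\mathcal{H}$ be a connected $r$-uniform hypergraph whose longest Berge path has length $r$. If there is a Berge path $P=v_0e_1v_1e_2\cdots v_{r-1}e_rv_r$ in $\mathcal{H}$ such that some edge of $\mathcal{H}$ containing $v_0$ is not among $e_1,\dots,e_r$, then $\mathcal{H}$ is the complete $r$-uniform hypergraph on $r+1$ vertices.
   Context: Hypergraphs are simple (no repeated edges). A Berge path of length $k$ is an alternating sequence $v_0e_1v_1\cdots v_{k-1}e_kv_k$ of distinct vertices and distinct edges with $v_{i-1},v_i\in e_i$. Connected means every two distinct vertices are joined by a Berge path. The complete $r$-uniform hypergraph on a vertex set has all $r$-subsets as edges. -}

module Defs where

open import Data.Nat using (ℕ; zero; suc; _<_)
open import Data.Fin using (Fin; zero; suc; inject₁; fromℕ)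
open import Data.Fin.Subset using (Subset; _∈_; ∣_∣)
open import Data.List using (List)
open import Data.List.Relation.Unary.All using (All)
open import Data.List.Relation.Unary.Unique.Propositional using (Unique)
open import Data.List.Membership.Propositional renaming (_∈_ to _∈ₗ_)
open import Data.Product using (Σ; _×_; ∃)
open import Relation.Binary.PropositionalEquality using (_≡_; _≢_)
open import Relation.Nullary using (¬_)
open import Function.Definitions using (Injective)

record UniformHypergraph (n r : ℕ) : Set where
  field
    edges   : List (Subset n)
    simple  : Unique edges
    uniform : All (λ e → ∣ e ∣ ≡ r) edges
open UniformHypergraph public

-- A Berge path of length k : v₀ e₁ v₁ ⋯ e_k v_k with distinct vertices,
-- distinct edges of H, and v_{i-1}, v_i ∈ e_i.
-- vert i is v_i (i = 0..k); edge i is e_{i+1} (i = 0..k-1).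
record BergePath {n r : ℕ} (H : UniformHypergraph n r) (k : ℕ) : Set where
  field
    vert      : Fin (suc k) → Fin n
    vert-inj  : Injective _≡_ _≡_ vert
    edge      : Fin k → Subset n
    edge-inj  : Injective _≡_ _≡_ edge
    edge-in-H : ∀ i → edge i ∈ₗ edges H
    left-in   : ∀ i → vert (inject₁ i) ∈ edge i
    right-in  : ∀ i → vert (suc i) ∈ edge i
open BergePath public

Connected : {n r : ℕ} → UniformHypergraph n r → Set
Connected {n} H = ∀ (u v : Fin n) → u ≢ v →
  Σ ℕ λ k → Σ (BergePath H k) λ P → (vert P zero ≡ u) × (vert P (fromℕ k) ≡ v)

LongestPathLength : {n r : ℕ} → UniformHypergraph n r → ℕ → Set
LongestPathLength H ℓ = BergePath H ℓ × (∀ k → ℓ < k → ¬ BergePath H k)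

IsCompleteOnSucR : {n r : ℕ} → UniformHypergraph n r → Set
IsCompleteOnSucR {n} {r} H = (n ≡ suc r) × (∀ (s : Subset n) → ∣ s ∣ ≡ r → s ∈ₗ edges H)

-- Since no Berge path is longer than r, the spare edge e at v₀ lies inside the r + 1
-- vertices of P (otherwise it extends P), so it misses exactly one of them. If it contains
-- v_r it closes P into a Berge cycle of length r + 1. Otherwise it contains v₁ and may
-- replace e₁, and then e₁ contains v_r, as two edges missing the same vertex of P coincide.
-- An edge meeting such a cycle lies inside its vertex set too: otherwise, opening the cycle
-- at the meeting vertex (or just after the edge, if it is a cycle edge) yields a path of
-- length r + 1. By connectivity the cycle then spans H, so n = r + 1, and its r + 1 distinct
-- edges are all the r-subsets of the vertex set.

module Submission where

open import Defs
open import Data.Nat using (ℕ; zero; suc)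
open import Data.Fin using (Fin; zero)
open import Data.Fin.Subset using (Subset; _∈_)
open import Data.List.Membership.Propositional using () renaming (_∈_ to _∈ₗ_)
open import Data.Product using (Σ; _×_)
open import Relation.Binary.PropositionalEquality using (_≢_)

import Data.Bool.Properties as Bool
open import Data.Fin.Base using (suc; toℕ; fromℕ; inject₁; lower₁; punchOut)
open import Data.Fin.Properties
  using (any?; suc-injective; toℕ-injective; toℕ<n; toℕ-fromℕ; toℕ-fromℕ<; fromℕ<-cong;
         toℕ-inject₁; toℕ-lower₁; inject₁-lower₁; lower₁-injective; punchOut-injective;
         injective⇒≤; cantor-schröder-bernstein)
  renaming (_≟_ to _≟ᶠ_)
open import Data.Fin.Subset using (⊤; ⊥; ⁅_⁆; _∪_; _-_; _⊆_; _∉_; ∣_∣; inside; outside)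
open import Data.Fin.Subset.Properties
  using (_∈?_; ∈⊤; ∉⊥; x∈⁅x⁆; x∈⁅y⁆⇒x≡y; x∈p∪q⁺; x∈p∪q⁻; x∈p∧x≢y⇒x∈p-y; x∈p⇒∣p-x∣<∣p∣;
         p⊆q⇒∣p∣≤∣q∣; p⊂q⇒∣p∣<∣q∣; ⊆-antisym; ∣⊥∣≡0; ∣⊤∣≡n; ∣⁅x⁆∣≡1)
open import Data.List.Relation.Unary.All using (lookup)
open import Data.Nat.Base using (NonZero; _≤_; _<_; _+_; _*_; _/_; _%_; z≤n; s≤s; z<s; s≤s⁻¹)
open import Data.Nat.DivMod
  using (_mod_; m≡m%n+[m/n]*n; [m+n]%n≡m%n; m<n⇒m%n≡m; n%n≡0; %-distribˡ-+; m%n%n≡m%n; m%n<n)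
open import Data.Nat.Properties
  using (≤-refl; ≤-trans; ≤-reflexive; <-≤-trans; <-irrefl; <⇒≢; <⇒≱; ≤∧≢⇒<; n≮0; n<1+n; n≤1+n;
         m<n⇒m<1+n; m≤n⇒m<n∨m≡n; +-suc; +-comm; +-assoc; +-identityʳ; +-monoʳ-≤;
         module ≤-Reasoning)
  renaming (_≟_ to _≟ⁿ_; suc-injective to suc-injectiveⁿ)
open import Data.Product using (_,_; ∃; proj₁; proj₂)
open import Data.Sum using (inj₁; inj₂)
open import Data.Vec.Base using ([]; _∷_)
open import Data.Vec.Properties using (≡-dec)
open import Data.Vec.Functional using () renaming (_∷_ to _◃_)
open import Function using (_∘_)
open import Function.Definitions using (Injective)
open import Relation.Binary.PropositionalEquality
  using (_≡_; refl; sym; trans; cong; subst; subst₂; module ≡-Reasoning)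
open import Relation.Nullary using (¬_; Dec; yes; no; ¬?; contradiction)
open import Relation.Nullary.Decidable using (decidable-stable)
open import Relation.Unary using (Pred; Decidable)

image : ∀ {k n} → (Fin k → Fin n) → Subset n
image {zero}  g = ⊥
image {suc k} g = ⁅ g zero ⁆ ∪ image (g ∘ suc)

∈-image⁺ : ∀ {k n} (g : Fin k → Fin n) i → g i ∈ image g
∈-image⁺ g zero    = x∈p∪q⁺ (inj₁ (x∈⁅x⁆ (g zero)))
∈-image⁺ g (suc i) = x∈p∪q⁺ (inj₂ (∈-image⁺ (g ∘ suc) i))

∈-image⁻ : ∀ {k n} (g : Fin k → Fin n) {x} → x ∈ image g → ∃ λ i → g i ≡ x
∈-image⁻ {zero}  g x∈g = contradiction x∈g ∉⊥
∈-image⁻ {suc k} g x∈g with x∈p∪q⁻ ⁅ g zero ⁆ (image (g ∘ suc)) x∈g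
... | inj₁ x∈g₀ = zero , sym (x∈⁅y⁆⇒x≡y (g zero) x∈g₀)
... | inj₂ x∈gₛ = let i , gᵢ≡x = ∈-image⁻ (g ∘ suc) x∈gₛ in suc i , gᵢ≡x

∣p∪q∣≤∣p∣+∣q∣ : ∀ {n} (p q : Subset n) → ∣ p ∪ q ∣ ≤ ∣ p ∣ + ∣ q ∣
∣p∪q∣≤∣p∣+∣q∣ []            []            = z≤n
∣p∪q∣≤∣p∣+∣q∣ (outside ∷ p) (outside ∷ q) = ∣p∪q∣≤∣p∣+∣q∣ p q
∣p∪q∣≤∣p∣+∣q∣ (outside ∷ p) (inside  ∷ q) =
  ≤-trans (s≤s (∣p∪q∣≤∣p∣+∣q∣ p q)) (≤-reflexive (sym (+-suc ∣ p ∣ ∣ q ∣)))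
∣p∪q∣≤∣p∣+∣q∣ (inside  ∷ p) (outside ∷ q) = s≤s (∣p∪q∣≤∣p∣+∣q∣ p q)
∣p∪q∣≤∣p∣+∣q∣ (inside  ∷ p) (inside  ∷ q) =
  s≤s (≤-trans (∣p∪q∣≤∣p∣+∣q∣ p q) (+-monoʳ-≤ ∣ p ∣ (n≤1+n ∣ q ∣)))

∣image∣≤ : ∀ {k n} (g : Fin k → Fin n) → ∣ image g ∣ ≤ k
∣image∣≤ {zero} {n} g = ≤-reflexive (∣⊥∣≡0 n)
∣image∣≤ {suc k}    g = begin
  ∣ ⁅ g zero ⁆ ∪ image (g ∘ suc) ∣        ≤⟨ ∣p∪q∣≤∣p∣+∣q∣ ⁅ g zero ⁆ (image (g ∘ suc)) ⟩
  ∣ ⁅ g zero ⁆ ∣ + ∣ image (g ∘ suc) ∣    ≡⟨ cong (_+ ∣ image (g ∘ suc) ∣) (∣⁅x⁆∣≡1 (g zero)) ⟩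
  suc ∣ image (g ∘ suc) ∣                 ≤⟨ s≤s (∣image∣≤ (g ∘ suc)) ⟩
  suc k                                   ∎
  where open ≤-Reasoning

p⊆q∧∣q∣≤1+∣p∣⇒p≡q-x : ∀ {n} {p q : Subset n} {x} →
                      p ⊆ q → ∣ q ∣ ≤ suc ∣ p ∣ → x ∈ q → x ∉ p → p ≡ q - x
p⊆q∧∣q∣≤1+∣p∣⇒p≡q-x {p = p} {q} {x} p⊆q ∣q∣≤1+∣p∣ x∈q x∉p = ⊆-antisym p⊆q-x q-x⊆p
  where
  p⊆q-x : p ⊆ q - x
  p⊆q-x y∈p = x∈p∧x≢y⇒x∈p-y (p⊆q y∈p) (λ { refl → x∉p y∈p })
  q-x⊆p : q - x ⊆ p
  q-x⊆p {y} y∈q-x with y ∈? p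
  ... | yes y∈p = y∈p
  ... | no  y∉p = contradiction (<-≤-trans (p⊂q⇒∣p∣<∣q∣ (p⊆q-x , y , y∈q-x , y∉p))
                                           (s≤s⁻¹ (≤-trans (x∈p⇒∣p-x∣<∣p∣ x∈q) ∣q∣≤1+∣p∣)))
                                (<-irrefl refl)

∣p∣<n⇒∃∉ : ∀ {n} (p : Subset n) → ∣ p ∣ < n → ∃ λ x → x ∉ p
∣p∣<n⇒∃∉ {n} p ∣p∣<n with any? (λ x → ¬? (x ∈? p))
... | yes x∉p = x∉p
... | no  ∄x∉p = contradiction (subst (_≤ ∣ p ∣) (∣⊤∣≡n n) (p⊆q⇒∣p∣≤∣q∣ ⊤⊆p)) (<⇒≱ ∣p∣<n)
  where
  ⊤⊆p : ⊤ ⊆ p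
  ⊤⊆p {x} _ = decidable-stable (x ∈? p) (λ x∉p → ∄x∉p (x , x∉p))

x∈p∧y∈p∧x≢y⇒2≤∣p∣ : ∀ {n} {p : Subset n} {x y} → x ∈ p → y ∈ p → x ≢ y → 2 ≤ ∣ p ∣
x∈p∧y∈p∧x≢y⇒2≤∣p∣ x∈p y∈p x≢y =
  ≤-trans (s≤s (≤-trans (s≤s z≤n) (x∈p⇒∣p-x∣<∣p∣ (x∈p∧x≢y⇒x∈p-y y∈p (x≢y ∘ sym)))))
          (x∈p⇒∣p-x∣<∣p∣ x∈p)

injective⇒surjective : ∀ {m n} {f : Fin m → Fin n} →
                       n ≤ m → Injective _≡_ _≡_ f → ∀ y → ∃ λ x → f x ≡ y
injective⇒surjective {m} {suc n} {f} n<m f-inj y with any? (λ x → f x ≟ᶠ y)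
... | yes hit  = hit
... | no  miss = contradiction (injective⇒≤ f′-inj) (<⇒≱ n<m)
  where
  y≢f : ∀ x → y ≢ f x
  y≢f x y≡fx = miss (x , sym y≡fx)
  f′ : Fin m → Fin n
  f′ x = punchOut (y≢f x)
  f′-inj : Injective _≡_ _≡_ f′
  f′-inj {x} {x′} eq = f-inj (punchOut-injective (y≢f x) (y≢f x′) eq)

injective∧surjective⇒≡ : ∀ {m n} {f : Fin m → Fin n} →
                         Injective _≡_ _≡_ f → (∀ y → ∃ λ x → f x ≡ y) → m ≡ n
injective∧surjective⇒≡ {f = f} f-inj f-surj = cantor-schröder-bernstein f-inj g-inj
  where
  g-inj : Injective _≡_ _≡_ (proj₁ ∘ f-surj)
  g-inj {y} {y′} eq = trans (sym (proj₂ (f-surj y))) (trans (cong f eq) (proj₂ (f-surj y′)))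

-- An r-subset of an (r + 1)-set is ⊤ - x for the one point x it misses, so distinct
-- r-subsets miss distinct points, and r + 1 of them miss every point.
distinct-r-subsets-exhaust : ∀ {n r} → suc r ≡ n → (d : Fin (suc r) → Subset n) →
                             Injective _≡_ _≡_ d → (∀ b → ∣ d b ∣ ≡ r) →
                             ∀ s → ∣ s ∣ ≡ r → ∃ λ b → d b ≡ s
distinct-r-subsets-exhaust {n} {r} 1+r≡n d d-inj ∣d∣≡r s ∣s∣≡r =
  let x , x∉s      = hole ∣s∣≡r
      b , miss-b≡x = injective⇒surjective (≤-reflexive (sym 1+r≡n)) miss-inj x
  in b , (begin
    d b          ≡⟨ d≡⊤-miss b ⟩
    ⊤ - miss b   ≡⟨ cong (⊤ -_) miss-b≡x ⟩
    ⊤ - x        ≡⟨ ⊤-hole ∣s∣≡r x∉s ⟨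
    s            ∎)
  where
  open ≡-Reasoning
  hole : ∀ {p} → ∣ p ∣ ≡ r → ∃ λ x → x ∉ p
  hole {p} ∣p∣≡r = ∣p∣<n⇒∃∉ p (subst₂ _<_ (sym ∣p∣≡r) 1+r≡n ≤-refl)
  ⊤-hole : ∀ {p x} → ∣ p ∣ ≡ r → x ∉ p → p ≡ ⊤ - x
  ⊤-hole ∣p∣≡r x∉p = p⊆q∧∣q∣≤1+∣p∣⇒p≡q-x (λ _ → ∈⊤)
    (≤-reflexive (trans (∣⊤∣≡n n) (trans (sym 1+r≡n) (cong suc (sym ∣p∣≡r))))) ∈⊤ x∉p
  miss : Fin (suc r) → Fin n
  miss b = proj₁ (hole (∣d∣≡r b))
  d≡⊤-miss : ∀ b → d b ≡ ⊤ - miss b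
  d≡⊤-miss b = ⊤-hole (∣d∣≡r b) (proj₂ (hole (∣d∣≡r b)))
  miss-inj : Injective _≡_ _≡_ miss
  miss-inj {b} {b′} eq = d-inj (trans (d≡⊤-miss b) (trans (cong (⊤ -_) eq) (sym (d≡⊤-miss b′))))

first-entry : ∀ {k p} {P : Pred (Fin (suc k)) p} → Decidable P →
              ¬ P zero → P (fromℕ k) → ∃ λ t → ¬ P (inject₁ t) × P (suc t)
first-entry {zero}  P? ¬P₀ Pₖ = contradiction Pₖ ¬P₀
first-entry {suc k} P? ¬P₀ Pₖ with P? (suc zero)
... | yes P₁  = zero , ¬P₀ , P₁
... | no  ¬P₁ = let t , ¬Pₜ , Pₜ₊₁ = first-entry (P? ∘ suc) ¬P₁ Pₖ in suc t , ¬Pₜ , Pₜ₊₁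

fresh-◃-injective : ∀ {k} {A : Set} {a : A} {f : Fin k → A} →
                    (∀ i → f i ≢ a) → Injective _≡_ _≡_ f → Injective _≡_ _≡_ (a ◃ f)
fresh-◃-injective a-new f-inj {zero}  {zero}  _  = refl
fresh-◃-injective a-new f-inj {zero}  {suc j} eq = contradiction (sym eq) (a-new j)
fresh-◃-injective a-new f-inj {suc i} {zero}  eq = contradiction eq (a-new i)
fresh-◃-injective a-new f-inj {suc i} {suc j} eq = cong suc (f-inj eq)

record Cyclic {A : Set} (m : ℕ) (F : ℕ → A) : Set where
  field
    periodic        : ∀ i → F (m + i) ≡ F i
    injective-below : ∀ {i j} → i < m → j < m → F i ≡ F j → i ≡ j
open Cyclic

suc-cyclic : ∀ {A : Set} {m} {F : ℕ → A} → Cyclic m F → Cyclic m (F ∘ suc)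
suc-cyclic {m = m} {F} F-cyclic = record
  { periodic        = λ i → trans (cong F (sym (+-suc m i))) (periodic F-cyclic (suc i))
  ; injective-below = injective
  }
  where
  Fₘ≡F₀ : F m ≡ F zero
  Fₘ≡F₀ = trans (cong F (sym (+-identityʳ m))) (periodic F-cyclic zero)
  injective : ∀ {i j} → i < m → j < m → F (suc i) ≡ F (suc j) → i ≡ j
  injective i<m j<m eq with m≤n⇒m<n∨m≡n i<m | m≤n⇒m<n∨m≡n j<m
  ... | inj₁ 1+i<m | inj₁ 1+j<m = suc-injectiveⁿ (injective-below F-cyclic 1+i<m 1+j<m eq)
  ... | inj₂ 1+i≡m | inj₂ 1+j≡m = suc-injectiveⁿ (trans 1+i≡m (sym 1+j≡m))
  ... | inj₁ 1+i<m | inj₂ refl  =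
    contradiction (injective-below F-cyclic 1+i<m z<s (trans eq Fₘ≡F₀)) λ ()
  ... | inj₂ refl  | inj₁ 1+j<m =
    contradiction (injective-below F-cyclic 1+j<m z<s (trans (sym eq) Fₘ≡F₀)) λ ()

shift-cyclic : ∀ {A : Set} {m} {F : ℕ → A} s → Cyclic m F → Cyclic m (λ i → F (s + i))
shift-cyclic zero    F-cyclic = F-cyclic
shift-cyclic (suc s) F-cyclic = shift-cyclic s (suc-cyclic F-cyclic)

cyclic-% : ∀ {A : Set} {k} {F : ℕ → A} → Cyclic (suc k) F → ∀ i → F i ≡ F (i % suc k)
cyclic-% {k = k} {F} F-cyclic i =
  trans (cong F i≡i%m+[i/m]*m) (periodic-multiple (i / suc k) (i % suc k))
  where
  i≡i%m+[i/m]*m : i ≡ i / suc k * suc k + i % suc k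
  i≡i%m+[i/m]*m = trans (m≡m%n+[m/n]*n i (suc k)) (+-comm (i % suc k) _)
  periodic-multiple : ∀ q j → F (q * suc k + j) ≡ F j
  periodic-multiple zero    j = refl
  periodic-multiple (suc q) j = trans (cong F (+-assoc (suc k) (q * suc k) j))
    (trans (periodic F-cyclic _) (periodic-multiple q j))

toℕ-mod : ∀ i k → toℕ (i mod suc k) ≡ i % suc k
toℕ-mod i k = toℕ-fromℕ< (m%n<n i (suc k))

mod-cyclic : ∀ {A : Set} {k} {g : Fin (suc k) → A} →
             Injective _≡_ _≡_ g → Cyclic (suc k) (λ i → g (i mod suc k))
mod-cyclic {k = k} {g} g-inj = record
  { periodic        = λ i → cong g (fromℕ<-cong _ _ (trans (cong (_% suc k) (+-comm (suc k) i))
                                                         ([m+n]%n≡m%n i (suc k))) _ _)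
  ; injective-below = λ {i} {j} i<m j<m eq → begin
      i                  ≡⟨ m<n⇒m%n≡m i<m ⟨
      i % suc k          ≡⟨ toℕ-mod i k ⟨
      toℕ (i mod suc k)  ≡⟨ cong toℕ (g-inj eq) ⟩
      toℕ (j mod suc k)  ≡⟨ toℕ-mod j k ⟩
      j % suc k          ≡⟨ m<n⇒m%n≡m j<m ⟩
      j                  ∎
  }
  where open ≡-Reasoning

suc-% : ∀ i m .{{_ : NonZero m}} → suc i % m ≡ suc (i % m) % m
suc-% i m = begin
  suc i % m                     ≡⟨ %-distribˡ-+ 1 i m ⟩
  (1 % m + i % m) % m           ≡⟨ cong (λ x → (1 % m + x) % m) (sym (m%n%n≡m%n i m)) ⟩
  (1 % m + i % m % m) % m       ≡⟨ sym (%-distribˡ-+ 1 (i % m) m) ⟩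
  suc (i % m) % m               ∎
  where open ≡-Reasoning

suc-mod-last : ∀ {i k} → k ≡ toℕ (i mod suc k) → suc i mod suc k ≡ zero
suc-mod-last {i} {k} k≡i%m = toℕ-injective (begin
  toℕ (suc i mod suc k)    ≡⟨ toℕ-mod (suc i) k ⟩
  suc i % suc k            ≡⟨ suc-% i (suc k) ⟩
  suc (i % suc k) % suc k  ≡⟨ cong (λ x → suc x % suc k) (trans k≡i%m (toℕ-mod i k)) ⟨
  suc k % suc k            ≡⟨ n%n≡0 (suc k) ⟩
  0                        ∎)
  where open ≡-Reasoning

suc-mod-step : ∀ {i k} (k≢i%m : k ≢ toℕ (i mod suc k)) →
               suc i mod suc k ≡ suc (lower₁ (i mod suc k) k≢i%m)
suc-mod-step {i} {k} k≢i%m = toℕ-injective (begin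
  toℕ (suc i mod suc k)                   ≡⟨ toℕ-mod (suc i) k ⟩
  suc i % suc k                           ≡⟨ suc-% i (suc k) ⟩
  suc (i % suc k) % suc k                 ≡⟨ m<n⇒m%n≡m (s≤s i%m<k) ⟩
  suc (i % suc k)                         ≡⟨ cong suc (toℕ-mod i k) ⟨
  suc (toℕ (i mod suc k))                 ≡⟨ cong suc (toℕ-lower₁ _ k≢i%m) ⟨
  suc (toℕ (lower₁ (i mod suc k) k≢i%m))  ∎)
  where
  open ≡-Reasoning
  i%m<k : i % suc k < k
  i%m<k = ≤∧≢⇒< (s≤s⁻¹ (m%n<n i (suc k))) (λ i%m≡k → k≢i%m (trans (sym i%m≡k) (sym (toℕ-mod i k))))

-- A Berge cycle of length suc k, unrolled periodically along ℕ so that rotating it is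
-- reindexing.
record BergeCycle {n r : ℕ} (H : UniformHypergraph n r) (k : ℕ) : Set where
  field
    vertexAt        : ℕ → Fin n
    edgeAt          : ℕ → Subset n
    vertexAt-cyclic : Cyclic (suc k) vertexAt
    edgeAt-cyclic   : Cyclic (suc k) edgeAt
    edgeAt-in-H     : ∀ i → edgeAt i ∈ₗ edges H
    vertexAt-in     : ∀ i → vertexAt i ∈ edgeAt i
    vertexAt-suc-in : ∀ i → vertexAt (suc i) ∈ edgeAt i
open BergeCycle

module _ {n r : ℕ} {H : UniformHypergraph n r} where

  edge-size : ∀ {e} → e ∈ₗ edges H → ∣ e ∣ ≡ r
  edge-size = lookup (uniform H)

  vertices : ∀ {k} → BergePath H k → Subset n
  vertices P = image (vert P)

  positive-path⇒2≤r : ∀ {k} → BergePath H (suc k) → 2 ≤ r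
  positive-path⇒2≤r P = subst (2 ≤_) (edge-size (edge-in-H P zero))
    (x∈p∧y∈p∧x≢y⇒2≤∣p∣ (left-in P zero) (right-in P zero) (λ eq → contradiction (vert-inj P eq) λ ()))

  prepend : ∀ {k} (P : BergePath H k) {g u} → g ∈ₗ edges H → u ∈ g → vert P zero ∈ g →
            (∀ i → edge P i ≢ g) → (∀ i → vert P i ≢ u) → BergePath H (suc k)
  prepend P g∈H u∈g v₀∈g g-new u-new = record
    { vert      = _ ◃ vert P
    ; vert-inj  = fresh-◃-injective u-new (vert-inj P)
    ; edge      = _ ◃ edge P
    ; edge-inj  = fresh-◃-injective g-new (edge-inj P)
    ; edge-in-H = λ { zero → g∈H ; (suc i) → edge-in-H P i }
    ; left-in   = λ { zero → u∈g ; (suc i) → left-in P i }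
    ; right-in  = λ { zero → v₀∈g ; (suc i) → right-in P i }
    }

  new-edge⊆vertices : ∀ {k g} → ¬ BergePath H (suc k) → (P : BergePath H k) →
                      g ∈ₗ edges H → vert P zero ∈ g → (∀ i → edge P i ≢ g) → g ⊆ vertices P
  new-edge⊆vertices no-longer P g∈H v₀∈g g-new {x} x∈g with x ∈? vertices P
  ... | yes x∈V = x∈V
  ... | no  x∉V = contradiction (prepend P g∈H x∈g v₀∈g g-new x-new) no-longer
    where
    x-new : ∀ i → vert P i ≢ x
    x-new i refl = x∉V (∈-image⁺ (vert P) i)

  replaceFirstEdge : ∀ {k e} (P : BergePath H (suc k)) → e ∈ₗ edges H →
                     vert P zero ∈ e → vert P (suc zero) ∈ e → (∀ i → edge P i ≢ e) →
                     BergePath H (suc k)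
  replaceFirstEdge P e∈H v₀∈e v₁∈e e-new = record
    { vert      = vert P
    ; vert-inj  = vert-inj P
    ; edge      = _ ◃ (edge P ∘ suc)
    ; edge-inj  = fresh-◃-injective (e-new ∘ suc) (suc-injective ∘ edge-inj P)
    ; edge-in-H = λ { zero → e∈H ; (suc i) → edge-in-H P (suc i) }
    ; left-in   = λ { zero → v₀∈e ; (suc i) → left-in P (suc i) }
    ; right-in  = λ { zero → v₁∈e ; (suc i) → right-in P (suc i) }
    }

  replaceFirstEdge-fresh : ∀ {k e} (P : BergePath H (suc k)) (e∈H : e ∈ₗ edges H)
                           (v₀∈e : vert P zero ∈ e) (v₁∈e : vert P (suc zero) ∈ e)
                           (e-new : ∀ i → edge P i ≢ e) →
                           ∀ i → edge (replaceFirstEdge P e∈H v₀∈e v₁∈e e-new) i ≢ edge P zero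
  replaceFirstEdge-fresh P _ _ _ e-new zero    eq = e-new zero (sym eq)
  replaceFirstEdge-fresh P _ _ _ _     (suc i) eq = contradiction (edge-inj P eq) λ ()

  rotate : ∀ {k} → ℕ → BergeCycle H k → BergeCycle H k
  rotate s C = record
    { vertexAt        = λ i → vertexAt C (s + i)
    ; edgeAt          = λ i → edgeAt C (s + i)
    ; vertexAt-cyclic = shift-cyclic s (vertexAt-cyclic C)
    ; edgeAt-cyclic   = shift-cyclic s (edgeAt-cyclic C)
    ; edgeAt-in-H     = λ i → edgeAt-in-H C (s + i)
    ; vertexAt-in     = λ i → vertexAt-in C (s + i)
    ; vertexAt-suc-in = λ i → subst (λ j → vertexAt C j ∈ edgeAt C (s + i)) (sym (+-suc s i))
                                    (vertexAt-suc-in C (s + i))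
    }

  toPath : ∀ {k} → BergeCycle H k → BergePath H k
  toPath C = record
    { vert      = λ i → vertexAt C (toℕ i)
    ; vert-inj  = λ {i} {j} eq →
        toℕ-injective (injective-below (vertexAt-cyclic C) (toℕ<n i) (toℕ<n j) eq)
    ; edge      = λ i → edgeAt C (toℕ i)
    ; edge-inj  = λ {i} {j} eq →
        toℕ-injective (injective-below (edgeAt-cyclic C) (m<n⇒m<1+n (toℕ<n i)) (m<n⇒m<1+n (toℕ<n j)) eq)
    ; edge-in-H = λ i → edgeAt-in-H C (toℕ i)
    ; left-in   = λ i → subst (λ j → vertexAt C j ∈ edgeAt C (toℕ i)) (sym (toℕ-inject₁ i))
                              (vertexAt-in C (toℕ i))
    ; right-in  = λ i → vertexAt-suc-in C (toℕ i)
    }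

  toPath-edge≢last : ∀ {k} (C : BergeCycle H k) i → edge (toPath C) i ≢ edgeAt C k
  toPath-edge≢last {k} C i eq =
    <⇒≢ (toℕ<n i) (injective-below (edgeAt-cyclic C) (m<n⇒m<1+n (toℕ<n i)) (n<1+n k) eq)

  vertexAt∈vertices : ∀ {k} (C : BergeCycle H k) i → vertexAt C i ∈ vertices (toPath C)
  vertexAt∈vertices {k} C i =
    subst (_∈ vertices (toPath C)) (sym cᵢ≡cᵢ%m) (∈-image⁺ (vert (toPath C)) (i mod suc k))
    where
    cᵢ≡cᵢ%m : vertexAt C i ≡ vertexAt C (toℕ (i mod suc k))
    cᵢ≡cᵢ%m = trans (cyclic-% (vertexAt-cyclic C) i) (cong (vertexAt C) (sym (toℕ-mod i k)))

  closePath : ∀ {k f} (P : BergePath H k) → f ∈ₗ edges H → vert P zero ∈ f →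
              vert P (fromℕ k) ∈ f → (∀ i → edge P i ≢ f) → BergeCycle H k
  closePath {k} {f} P f∈H v₀∈f vₖ∈f f-new = record
    { vertexAt        = λ i → vert P (i mod suc k)
    ; edgeAt          = λ i → cycleEdge (i mod suc k)
    ; vertexAt-cyclic = mod-cyclic (vert-inj P)
    ; edgeAt-cyclic   = mod-cyclic cycleEdge-injective
    ; edgeAt-in-H     = λ i → cycleEdge-in-H (i mod suc k)
    ; vertexAt-in     = λ i → vert∈cycleEdge (i mod suc k)
    ; vertexAt-suc-in = next-vert∈cycleEdge
    }
    where
    cycleEdge : Fin (suc k) → Subset n
    cycleEdge j with k ≟ⁿ toℕ j
    ... | yes _   = f
    ... | no  k≢j = edge P (lower₁ j k≢j)

    cycleEdge-in-H : ∀ j → cycleEdge j ∈ₗ edges H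
    cycleEdge-in-H j with k ≟ⁿ toℕ j
    ... | yes _   = f∈H
    ... | no  k≢j = edge-in-H P (lower₁ j k≢j)

    cycleEdge-injective : Injective _≡_ _≡_ cycleEdge
    cycleEdge-injective {j} {j′} eq with k ≟ⁿ toℕ j | k ≟ⁿ toℕ j′
    ... | yes k≡j | yes k≡j′ = toℕ-injective (trans (sym k≡j) k≡j′)
    ... | yes _   | no  _    = contradiction (sym eq) (f-new _)
    ... | no  _   | yes _    = contradiction eq (f-new _)
    ... | no  _   | no  _    = lower₁-injective (edge-inj P eq)

    vert∈cycleEdge : ∀ j → vert P j ∈ cycleEdge j
    vert∈cycleEdge j with k ≟ⁿ toℕ j
    ... | yes k≡j = subst (λ j → vert P j ∈ f) (toℕ-injective (trans (toℕ-fromℕ k) k≡j)) vₖ∈f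
    ... | no  k≢j = subst (λ i → vert P i ∈ edge P (lower₁ j k≢j)) (inject₁-lower₁ j k≢j)
                          (left-in P (lower₁ j k≢j))

    next-vert∈cycleEdge : ∀ i → vert P (suc i mod suc k) ∈ cycleEdge (i mod suc k)
    next-vert∈cycleEdge i with k ≟ⁿ toℕ (i mod suc k)
    ... | yes k≡j = subst (λ j → vert P j ∈ f) (sym (suc-mod-last k≡j)) v₀∈f
    ... | no  k≢j = subst (λ j → vert P j ∈ edge P (lower₁ (i mod suc k) k≢j)) (sym (suc-mod-step k≢j))
                          (right-in P (lower₁ (i mod suc k) k≢j))

  extend-cycle : ∀ {k g u} (C : BergeCycle H k) → g ∈ₗ edges H → u ∈ g →
                 vertexAt C zero ∈ g → (∀ i → vertexAt C i ≢ u) → BergePath H (suc k)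
  extend-cycle {k} {g} C g∈H u∈g c₀∈g u-off
    with any? (λ (t : Fin k) → ≡-dec Bool._≟_ (edgeAt C (toℕ t)) g)
  ... | no g-off = prepend (toPath C) g∈H u∈g c₀∈g (λ t eq → g-off (t , eq)) (u-off ∘ toℕ)
  -- g is the cycle edge eₜ: open the cycle right after it, so that g is the edge left out.
  ... | yes (t , eₜ≡g) =
    prepend (toPath C′) g∈H u∈g c′₀∈g (λ i eq → toPath-edge≢last C′ i (trans eq g≡last))
            (λ i → u-off (suc (toℕ t) + toℕ i))
    where
    C′ : BergeCycle H k
    C′ = rotate (suc (toℕ t)) C
    c′₀∈g : vertexAt C′ zero ∈ g
    c′₀∈g = subst₂ _∈_ (cong (vertexAt C) (sym (+-identityʳ (suc (toℕ t))))) eₜ≡g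
                   (vertexAt-suc-in C (toℕ t))
    g≡last : g ≡ edgeAt C′ k
    g≡last = sym (trans (cong (edgeAt C) (cong suc (+-comm (toℕ t) k)))
                        (trans (periodic (edgeAt-cyclic C) (toℕ t)) eₜ≡g))

  edge-meeting-cycle⊆vertices : ∀ {k g x} → ¬ BergePath H (suc k) → (C : BergeCycle H k) →
                                g ∈ₗ edges H → x ∈ g → x ∈ vertices (toPath C) →
                                g ⊆ vertices (toPath C)
  edge-meeting-cycle⊆vertices {g = g} no-longer C g∈H x∈g x∈V {y} y∈g
    with y ∈? vertices (toPath C) | ∈-image⁻ (vert (toPath C)) x∈V
  ... | yes y∈V | _        = y∈V
  ... | no  y∉V | (i , refl) = contradiction (extend-cycle C′ g∈H y∈g c′₀∈g y-off) no-longer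
    where
    C′ : BergeCycle H _
    C′ = rotate (toℕ i) C
    c′₀∈g : vertexAt C′ zero ∈ g
    c′₀∈g = subst (_∈ g) (cong (vertexAt C) (sym (+-identityʳ (toℕ i)))) x∈g
    y-off : ∀ j → vertexAt C′ j ≢ y
    y-off j refl = y∉V (vertexAt∈vertices C (toℕ i + j))

  connected⇒closed-set-full : Connected H → (V : Subset n) →
                              (∀ {g x} → g ∈ₗ edges H → x ∈ g → x ∈ V → g ⊆ V) →
                              ∀ {v} → v ∈ V → ∀ x → x ∈ V
  connected⇒closed-set-full conn V closed {v} v∈V x with x ∈? V
  ... | yes x∈V = x∈V
  ... | no  x∉V =
    let k , R , R₀≡x , Rₖ≡v = conn x v (λ { refl → x∉V v∈V })
        t , Rₜ∉V , Rₜ₊₁∈V = first-entry (λ j → vert R j ∈? V) (λ R₀∈V → x∉V (subst (_∈ V) R₀≡x R₀∈V))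
                                        (subst (_∈ V) (sym Rₖ≡v) v∈V)
    in contradiction (closed (edge-in-H R t) (right-in R t) Rₜ₊₁∈V (left-in R t)) Rₜ∉V

  cycle⇒complete : Connected H → ¬ BergePath H (suc r) → BergeCycle H r → IsCompleteOnSucR H
  cycle⇒complete conn no-longer C = n≡1+r , r-subset∈H
    where
    spans : ∀ x → ∃ λ i → vert (toPath C) i ≡ x
    spans x = ∈-image⁻ (vert (toPath C)) (connected⇒closed-set-full conn (vertices (toPath C))
                (edge-meeting-cycle⊆vertices no-longer C) (∈-image⁺ (vert (toPath C)) zero) x)
    n≡1+r : n ≡ suc r
    n≡1+r = sym (injective∧surjective⇒≡ (vert-inj (toPath C)) spans)
    edges-distinct : Injective _≡_ _≡_ (edgeAt C ∘ toℕ)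
    edges-distinct {b} {b′} eq =
      toℕ-injective (injective-below (edgeAt-cyclic C) (toℕ<n b) (toℕ<n b′) eq)
    r-subset∈H : ∀ s → ∣ s ∣ ≡ r → s ∈ₗ edges H
    r-subset∈H s ∣s∣≡r =
      let b , eᵦ≡s = distinct-r-subsets-exhaust (sym n≡1+r) (edgeAt C ∘ toℕ) edges-distinct
                                                 (λ b → edge-size (edgeAt-in-H C (toℕ b))) s ∣s∣≡r
      in subst (_∈ₗ edges H) eᵦ≡s (edgeAt-in-H C (toℕ b))

module _ {n r : ℕ} {H : UniformHypergraph n (suc (suc r))} where

  spare-edge⇒cycle : ∀ {e} → ¬ BergePath H (suc (suc (suc r))) → (P : BergePath H (suc (suc r))) →
                     e ∈ₗ edges H → vert P zero ∈ e → (∀ i → edge P i ≢ e) → BergeCycle H (suc (suc r))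
  spare-edge⇒cycle {e} no-longer P e∈H v₀∈e e-new = by-cases (vₗ ∈? e) (vₗ ∈? edge P zero)
    where
    vₗ : Fin n
    vₗ = vert P (fromℕ (suc (suc r)))
    ≡V-vₗ : ∀ {f} → f ∈ₗ edges H → f ⊆ vertices P → vₗ ∉ f → f ≡ vertices P - vₗ
    ≡V-vₗ f∈H f⊆V vₗ∉f = p⊆q∧∣q∣≤1+∣p∣⇒p≡q-x f⊆V
      (subst (λ m → ∣ vertices P ∣ ≤ suc m) (sym (edge-size {H = H} f∈H)) (∣image∣≤ (vert P)))
      (∈-image⁺ (vert P) _) vₗ∉f
    e≡V-vₗ : vₗ ∉ e → e ≡ vertices P - vₗ
    e≡V-vₗ = ≡V-vₗ e∈H (new-edge⊆vertices no-longer P e∈H v₀∈e e-new)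
    v₁∈e : vₗ ∉ e → vert P (suc zero) ∈ e
    v₁∈e vₗ∉e = subst (vert P (suc zero) ∈_) (sym (e≡V-vₗ vₗ∉e))
      (x∈p∧x≢y⇒x∈p-y (∈-image⁺ (vert P) (suc zero)) (λ v₁≡vₗ → contradiction (vert-inj P v₁≡vₗ) λ ()))
    P′ : vₗ ∉ e → BergePath H (suc (suc r))
    P′ vₗ∉e = replaceFirstEdge P e∈H v₀∈e (v₁∈e vₗ∉e) e-new
    e₁-fresh : ∀ vₗ∉e i → edge (P′ vₗ∉e) i ≢ edge P zero
    e₁-fresh vₗ∉e = replaceFirstEdge-fresh P e∈H v₀∈e (v₁∈e vₗ∉e) e-new
    by-cases : Dec (vₗ ∈ e) → Dec (vₗ ∈ edge P zero) → BergeCycle H (suc (suc r))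
    by-cases (yes vₗ∈e) _           = closePath P e∈H v₀∈e vₗ∈e e-new
    by-cases (no  vₗ∉e) (yes vₗ∈e₁) =
      closePath (P′ vₗ∉e) (edge-in-H P zero) (left-in P zero) vₗ∈e₁ (e₁-fresh vₗ∉e)
    by-cases (no  vₗ∉e) (no  vₗ∉e₁) =
      contradiction (trans (e≡V-vₗ vₗ∉e) (sym e₁≡V-vₗ)) (e-new zero ∘ sym)
      where
      e₁≡V-vₗ : edge P zero ≡ vertices P - vₗ
      e₁≡V-vₗ = ≡V-vₗ (edge-in-H P zero)
        (new-edge⊆vertices no-longer (P′ vₗ∉e) (edge-in-H P zero) (left-in P zero) (e₁-fresh vₗ∉e)) vₗ∉e₁

corollary3p4 : (n r : ℕ) (H : UniformHypergraph n r) →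
    Connected H → LongestPathLength H r →
    (P : BergePath H r) →
    Σ (Subset n) (λ e → (e ∈ₗ edges H) × (vert P zero ∈ e) × (∀ i → edge P i ≢ e)) →
    IsCompleteOnSucR H
corollary3p4 n zero H _ _ P (e , e∈H , v₀∈e , _) =
  contradiction (subst (∣ e - vert P zero ∣ <_) (edge-size {H = H} e∈H) (x∈p⇒∣p-x∣<∣p∣ v₀∈e)) n≮0
corollary3p4 n (suc zero) H _ _ P _ = contradiction (positive-path⇒2≤r P) λ { (s≤s ()) }
corollary3p4 n (suc (suc r)) H conn (_ , longest) P (e , e∈H , v₀∈e , e-new) =
  cycle⇒complete conn no-longer (spare-edge⇒cycle no-longer P e∈H v₀∈e e-new)
  where
  no-longer : ¬ BergePath H (suc (suc (suc r)))
  no-longer = longest _ ≤-refl
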